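{- Let $x, y \in \mathbb{Z}$ and let $p \geq 3$ be a prime such that $x^2 - 2 = y^p$ and $y \neq -1$. If $3 \mid x$, then $y \equiv 7 \pmod{24}$; if $3 \nmid x$, then $y \equiv 23 \pmod{24}$. Moreover, $3 \mid (y-1)$ if and only if $3 \mid x$. -}

module Defs where

{-# OPTIONS --safe #-}
module Submission where

-- For odd p ≥ 3 every power y ^ p is congruent to y ^ 3 modulo 24, because a ^ 5 ≡ a ^ 3 (mod 24)
-- for every integer a (inspect the 24 residues) and the exponent can be lowered two at a time.
-- The equation thus reduces to x ^ 2 - 2 ≡ y ^ 3 (mod 24), and running through all pairs of
-- residues shows that this forces y ≡ 7 if 3 ∣ x and y ≡ 23 otherwise; the last claim follows
-- because 3 ∣ 7 - 1 but 3 ∤ 23 - 1.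

open import Defs
open import Data.Nat using (ℕ; _≥_)
open import Data.Nat.Primality using (Prime)
open import Data.Integer using (ℤ; +_; -[1+_]; _-_; _^_)
open import Data.Integer.Divisibility using (_∣_)
open import Data.Product using (_×_)
open import Relation.Binary.PropositionalEquality using (_≡_; _≢_)
open import Relation.Nullary using (¬_)
open import Function.Bundles using (_⇔_)

import Data.Nat as ℕ
import Data.Nat.Properties as ℕ
import Data.Nat.Divisibility as ℕ
open import Data.Nat.Primality using (prime⇒irreducible)
open import Data.Fin using (Fin; toℕ; fromℕ<)
open import Data.Fin.Properties using (all?; toℕ-fromℕ<)
open import Data.Integer using (_+_; _*_; -_; _%_; _/_)
open import Data.Integer.Properties using (^-distribˡ-+-*)
open import Data.Integer.DivMod using (a≡a%n+[a/n]*n; n%d<d)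
-- The statement's _∣_ only compares absolute values; the ring-theoretic lemmas live with the signed _∣ₛ_.
open import Data.Integer.Divisibility.Signed
  using (divides; ∣ᵤ⇒∣; ∣⇒∣ᵤ; ∣-trans; ∣m⇒∣-m; ∣m∣n⇒∣m+n; ∣n⇒∣m*n; ∣m⇒∣m*n)
  renaming (_∣_ to _∣ₛ_; _∣?_ to _∣ₛ?_)
open import Data.Integer.Tactic.RingSolver using (solve-∀)
open import Data.Product using (_,_; proj₁; proj₂; ∃-syntax)
open import Data.Sum using (_⊎_; inj₁; inj₂)
open import Relation.Nullary using (Dec; yes; no; contradiction)
open import Relation.Nullary.Decidable using (from-yes; from-no; map′; ¬?; _×-dec_; _→-dec_)
open import Relation.Binary.Bundles using (Setoid)
import Relation.Binary.Reasoning.Setoid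
open import Relation.Binary.Structures using (IsEquivalence)
open import Relation.Binary.PropositionalEquality using (refl; sym; cong; subst; module ≡-Reasoning)
open import Function.Bundles using (mk⇔; Equivalence)
open import Function.Base using (_∘_)

infix 4 _≡_mod_ _≡?_mod_

record _≡_mod_ (a b n : ℤ) : Set where
  constructor ≡-mod
  field n∣a-b : n ∣ₛ a - b

open _≡_mod_

module _ {n : ℤ} where

  ≡-mod-reflexive : ∀ {a b} → a ≡ b → a ≡ b mod n
  ≡-mod-reflexive {a} refl = ≡-mod (divides (+ 0) (a-a≡0*n a n))
    where
    a-a≡0*n : ∀ a n → a - a ≡ + 0 * n
    a-a≡0*n = solve-∀

  ≡-mod-refl : ∀ {a} → a ≡ a mod n
  ≡-mod-refl = ≡-mod-reflexive refl

  ≡-mod-sym : ∀ {a b} → a ≡ b mod n → b ≡ a mod n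
  ≡-mod-sym {a} {b} (≡-mod n∣a-b) = ≡-mod (subst (n ∣ₛ_) (-[a-b]≡b-a a b) (∣m⇒∣-m n∣a-b))
    where
    -[a-b]≡b-a : ∀ a b → - (a - b) ≡ b - a
    -[a-b]≡b-a = solve-∀

  ≡-mod-trans : ∀ {a b c} → a ≡ b mod n → b ≡ c mod n → a ≡ c mod n
  ≡-mod-trans {a} {b} {c} (≡-mod n∣a-b) (≡-mod n∣b-c) =
    ≡-mod (subst (n ∣ₛ_) (telescope a b c) (∣m∣n⇒∣m+n n∣a-b n∣b-c))
    where
    telescope : ∀ a b c → (a - b) + (b - c) ≡ a - c
    telescope = solve-∀

  ≡-mod-isEquivalence : IsEquivalence (_≡_mod n)
  ≡-mod-isEquivalence = record
    { refl = ≡-mod-refl ; sym = ≡-mod-sym ; trans = ≡-mod-trans }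

  ≡-mod-setoid : Setoid _ _
  ≡-mod-setoid = record { isEquivalence = ≡-mod-isEquivalence }

  *-cong-mod : ∀ {a b c d} → a ≡ c mod n → b ≡ d mod n → a * b ≡ c * d mod n
  *-cong-mod {a} {b} {c} {d} (≡-mod n∣a-c) (≡-mod n∣b-d) =
    ≡-mod (subst (n ∣ₛ_) (split a b c d) (∣m∣n⇒∣m+n (∣n⇒∣m*n a n∣b-d) (∣m⇒∣m*n d n∣a-c)))
    where
    split : ∀ a b c d → a * (b - d) + (a - c) * d ≡ a * b - c * d
    split = solve-∀

  -cong-mod : ∀ {a b c d} → a ≡ c mod n → b ≡ d mod n → a - b ≡ c - d mod n
  -cong-mod {a} {b} {c} {d} (≡-mod n∣a-c) (≡-mod n∣b-d) =
    ≡-mod (subst (n ∣ₛ_) (split a b c d) (∣m∣n⇒∣m+n n∣a-c (∣m⇒∣-m n∣b-d)))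
    where
    split : ∀ a b c d → (a - c) + - (b - d) ≡ (a - b) - (c - d)
    split = solve-∀

  ^-cong-mod : ∀ {a b} k → a ≡ b mod n → a ^ k ≡ b ^ k mod n
  ^-cong-mod ℕ.zero    a≡b = ≡-mod-refl
  ^-cong-mod (ℕ.suc k) a≡b = *-cong-mod a≡b (^-cong-mod k a≡b)

  ∣-resp-≡-mod : ∀ {a b} → a ≡ b mod n → n ∣ₛ a → n ∣ₛ b
  ∣-resp-≡-mod {a} {b} (≡-mod n∣a-b) n∣a =
    subst (n ∣ₛ_) (a-[a-b]≡b a b) (∣m∣n⇒∣m+n n∣a (∣m⇒∣-m n∣a-b))
    where
    a-[a-b]≡b : ∀ a b → a + - (a - b) ≡ b
    a-[a-b]≡b = solve-∀

module ≡-mod-Reasoning (n : ℤ) = Relation.Binary.Reasoning.Setoid (≡-mod-setoid {n})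

^-periodic-mod : ∀ {n} a m d → a ^ (m ℕ.+ d) ≡ a ^ m mod n →
                 ∀ k → a ^ (m ℕ.+ k ℕ.* d) ≡ a ^ m mod n
^-periodic-mod a m d period ℕ.zero    = ≡-mod-reflexive (cong (a ^_) (ℕ.+-identityʳ m))
^-periodic-mod {n} a m d period (ℕ.suc k) = begin
  a ^ (m ℕ.+ (d ℕ.+ k ℕ.* d))   ≡⟨ cong (a ^_) (ℕ.+-assoc m d (k ℕ.* d)) ⟨
  a ^ (m ℕ.+ d ℕ.+ k ℕ.* d)     ≡⟨ ^-distribˡ-+-* a (m ℕ.+ d) (k ℕ.* d) ⟩
  a ^ (m ℕ.+ d) * a ^ (k ℕ.* d) ≈⟨ *-cong-mod period ≡-mod-refl ⟩
  a ^ m * a ^ (k ℕ.* d)         ≡⟨ ^-distribˡ-+-* a m (k ℕ.* d) ⟨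
  a ^ (m ℕ.+ k ℕ.* d)           ≈⟨ ^-periodic-mod a m d period k ⟩
  a ^ m                         ∎
  where open ≡-mod-Reasoning n

≡-mod-weaken : ∀ {m n a b} → m ∣ₛ n → a ≡ b mod n → a ≡ b mod m
≡-mod-weaken m∣n (≡-mod n∣a-b) = ≡-mod (∣-trans m∣n n∣a-b)

≡-mod-24⇒≡-mod-3 : ∀ {a b} → a ≡ b mod + 24 → a ≡ b mod + 3
≡-mod-24⇒≡-mod-3 = ≡-mod-weaken (divides (+ 8) refl)

_≡?_mod_ : ∀ a b n → Dec (a ≡ b mod n)
a ≡? b mod n = map′ ≡-mod n∣a-b (n ∣ₛ? a - b)

residue : ∀ {n} .{{_ : ℕ.NonZero n}} a → ∃[ r ] a ≡ + toℕ {n} r mod + n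
residue {n} a = fromℕ< a%n<n , ≡-mod (divides (a / + n) (begin
  a - + toℕ (fromℕ< a%n<n)                  ≡⟨ cong (λ r → a - + r) (toℕ-fromℕ< a%n<n) ⟩
  a - + (a % + n)                           ≡⟨ cong (_- + (a % + n)) (a≡a%n+[a/n]*n a (+ n)) ⟩
  + (a % + n) + a / + n * + n - + (a % + n) ≡⟨ r+q*n-r≡q*n (+ (a % + n)) (a / + n) (+ n) ⟩
  a / + n * + n                             ∎))
  where
  open ≡-Reasoning
  a%n<n : a % + n ℕ.< n
  a%n<n = n%d<d a (+ n)
  r+q*n-r≡q*n : ∀ r q n → r + q * n - r ≡ q * n
  r+q*n-r≡q*n = solve-∀

^5≡^3-mod-24 : ∀ a → a ^ 5 ≡ a ^ 3 mod + 24
^5≡^3-mod-24 a with r , a≡r ← residue {24} a = begin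
  a ^ 5         ≈⟨ ^-cong-mod 5 a≡r ⟩
  (+ toℕ r) ^ 5 ≈⟨ table r ⟩
  (+ toℕ r) ^ 3 ≈⟨ ^-cong-mod 3 a≡r ⟨
  a ^ 3         ∎
  where
  open ≡-mod-Reasoning (+ 24)
  table : ∀ (r : Fin 24) → (+ toℕ r) ^ 5 ≡ (+ toℕ r) ^ 3 mod + 24
  table = from-yes (all? {n = 24} λ r → (+ toℕ r) ^ 5 ≡? (+ toℕ r) ^ 3 mod + 24)

^[3+2k]≡^3-mod-24 : ∀ a k → a ^ (3 ℕ.+ k ℕ.* 2) ≡ a ^ 3 mod + 24
^[3+2k]≡^3-mod-24 a = ^-periodic-mod a 3 2 (^5≡^3-mod-24 a)

even-or-odd : ∀ n → ∃[ k ] (n ≡ k ℕ.* 2 ⊎ n ≡ 1 ℕ.+ k ℕ.* 2)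
even-or-odd ℕ.zero = 0 , inj₁ refl
even-or-odd (ℕ.suc n) with even-or-odd n
... | k , inj₁ refl = k , inj₂ refl
... | k , inj₂ refl = ℕ.suc k , inj₁ refl

prime≥3⇒odd : ∀ {p} → Prime p → p ≥ 3 → ∃[ k ] p ≡ 3 ℕ.+ k ℕ.* 2
prime≥3⇒odd {p} p-prime p≥3 with even-or-odd p
... | ℕ.suc j , inj₂ refl = j , refl
... | ℕ.zero  , inj₂ refl = contradiction p≥3 λ { (ℕ.s≤s ()) }
... | k       , inj₁ refl with prime⇒irreducible p-prime (ℕ.divides k refl)
...   | inj₁ ()
...   | inj₂ 2≡p = contradiction (subst (3 ℕ.≤_) (sym 2≡p) p≥3) λ { (ℕ.s≤s (ℕ.s≤s ())) }

ResidueDichotomy : ℤ → ℤ → Set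
ResidueDichotomy x y = (+ 3 ∣ₛ x → y ≡ + 7 mod + 24) × (¬ + 3 ∣ₛ x → y ≡ + 23 mod + 24)

square-2≡cube⇒dichotomy-Fin : ∀ (r s : Fin 24) →
  (+ toℕ r) ^ 2 - + 2 ≡ (+ toℕ s) ^ 3 mod + 24 → ResidueDichotomy (+ toℕ r) (+ toℕ s)
square-2≡cube⇒dichotomy-Fin = from-yes (all? {n = 24} λ r → all? {n = 24} λ s →
  let x = + toℕ r ; y = + toℕ s in
  (x ^ 2 - + 2 ≡? y ^ 3 mod + 24) →-dec
    (((+ 3 ∣ₛ? x) →-dec (y ≡? + 7 mod + 24)) ×-dec
     (¬? (+ 3 ∣ₛ? x) →-dec (y ≡? + 23 mod + 24))))

dichotomy-resp-≡-mod : ∀ {x x′ y y′} → x ≡ x′ mod + 24 → y ≡ y′ mod + 24 →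
                       ResidueDichotomy x′ y′ → ResidueDichotomy x y
dichotomy-resp-≡-mod {x} {x′} x≡x′ y≡y′ (3∣x′⇒y′≡7 , 3∤x′⇒y′≡23) =
  (λ 3∣x → ≡-mod-trans y≡y′ (3∣x′⇒y′≡7 (∣-resp-≡-mod x≡x′[3] 3∣x))) ,
  (λ 3∤x → ≡-mod-trans y≡y′ (3∤x′⇒y′≡23 (3∤x ∘ ∣-resp-≡-mod (≡-mod-sym x≡x′[3]))))
  where
  x≡x′[3] : x ≡ x′ mod + 3
  x≡x′[3] = ≡-mod-24⇒≡-mod-3 x≡x′

square-2≡cube⇒dichotomy : ∀ x y → x ^ 2 - + 2 ≡ y ^ 3 mod + 24 → ResidueDichotomy x y
square-2≡cube⇒dichotomy x y x²-2≡y³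
  with r , x≡r ← residue {24} x | s , y≡s ← residue {24} y =
  dichotomy-resp-≡-mod x≡r y≡s (square-2≡cube⇒dichotomy-Fin r s r²-2≡s³)
  where
  r²-2≡s³ : (+ toℕ r) ^ 2 - + 2 ≡ (+ toℕ s) ^ 3 mod + 24
  r²-2≡s³ = begin
    (+ toℕ r) ^ 2 - + 2 ≈⟨ -cong-mod (^-cong-mod 2 x≡r) ≡-mod-refl ⟨
    x ^ 2 - + 2         ≈⟨ x²-2≡y³ ⟩
    y ^ 3               ≈⟨ ^-cong-mod 3 y≡s ⟩
    (+ toℕ s) ^ 3       ∎
    where open ≡-mod-Reasoning (+ 24)

dichotomy⇒[3∣y-1⇔3∣x] : ∀ {x y} → ResidueDichotomy x y → (+ 3 ∣ₛ y - + 1) ⇔ (+ 3 ∣ₛ x)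
dichotomy⇒[3∣y-1⇔3∣x] {x} {y} (y≡7 , y≡23) = mk⇔ 3∣y-1⇒3∣x 3∣x⇒3∣y-1
  where
  y-1≡c-1[3] : ∀ {c} → y ≡ c mod + 24 → y - + 1 ≡ c - + 1 mod + 3
  y-1≡c-1[3] y≡c = ≡-mod-24⇒≡-mod-3 (-cong-mod y≡c ≡-mod-refl)
  3∣x⇒3∣y-1 : + 3 ∣ₛ x → + 3 ∣ₛ y - + 1
  3∣x⇒3∣y-1 3∣x = ∣-resp-≡-mod (≡-mod-sym (y-1≡c-1[3] (y≡7 3∣x))) (divides (+ 2) refl)
  3∣y-1⇒3∣x : + 3 ∣ₛ y - + 1 → + 3 ∣ₛ x
  3∣y-1⇒3∣x 3∣y-1 with + 3 ∣ₛ? x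
  ... | yes 3∣x = 3∣x
  ... | no  3∤x = contradiction (∣-resp-≡-mod (y-1≡c-1[3] (y≡23 3∤x)) 3∣y-1) (from-no (+ 3 ∣ₛ? + 22))

theorem2p5 : (x y : ℤ) (p : ℕ) → Prime p → p ≥ 3 →
    x ^ 2 - + 2 ≡ y ^ p → y ≢ -[1+ 0 ] →
    ((+ 3 ∣ x → + 24 ∣ (y - + 7)) ×
     (¬ (+ 3 ∣ x) → + 24 ∣ (y - + 23)) ×
     ((+ 3 ∣ (y - + 1)) ⇔ (+ 3 ∣ x)))
theorem2p5 x y p p-prime p≥3 x²-2≡yᵖ _ =
  (λ 3∣x → ∣⇒∣ᵤ (n∣a-b (y≡7 (∣ᵤ⇒∣ 3∣x)))) ,
  (λ 3∤x → ∣⇒∣ᵤ (n∣a-b (y≡23 (3∤x ∘ ∣⇒∣ᵤ)))) ,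
  mk⇔ (∣⇒∣ᵤ ∘ Equivalence.to 3∣y-1⇔3∣x ∘ ∣ᵤ⇒∣) (∣⇒∣ᵤ ∘ Equivalence.from 3∣y-1⇔3∣x ∘ ∣ᵤ⇒∣)
  where
  x²-2≡y³ : x ^ 2 - + 2 ≡ y ^ 3 mod + 24
  x²-2≡y³ with k , refl ← prime≥3⇒odd p-prime p≥3 =
    ≡-mod-trans (≡-mod-reflexive x²-2≡yᵖ) (^[3+2k]≡^3-mod-24 y k)
  dichotomy : ResidueDichotomy x y
  dichotomy = square-2≡cube⇒dichotomy x y x²-2≡y³
  y≡7 : + 3 ∣ₛ x → y ≡ + 7 mod + 24
  y≡7 = proj₁ dichotomy
  y≡23 : ¬ + 3 ∣ₛ x → y ≡ + 23 mod + 24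
  y≡23 = proj₂ dichotomy
  3∣y-1⇔3∣x : (+ 3 ∣ₛ y - + 1) ⇔ (+ 3 ∣ₛ x)
  3∣y-1⇔3∣x = dichotomy⇒[3∣y-1⇔3∣x] dichotomy
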